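{- Let $r\ge2$ and let $(a_n)_{n\ge0}$, $(A'_n)_{n\ge0}$ be sequences with $A'_n=a_n\prod_{k=0}^{n-1}(1+u_rq^k)$. Then [$a_0=1$ and for all $n\ge1$ $$(1-q^n)a_n=\sum_{m=1}^r\sum_{i=0}^{r-1}e_{m,i}\,q^{i(n-m)}(-1)^{m+1}a_{n-m}\,]$$ if and only if [$A'_0=1$ and for all $n\ge1$ $$(1-q^n)A'_n=\sum_{m=1}^r\Big(\sum_{\nu=0}^{r-1}\sum_{\mu=0}^{\min(m-1,\nu)}f_{m,\mu}e_{m,\nu-\mu}q^{\nu(n-m)}+u_r\sum_{\nu=1}^{r}\sum_{\mu=0}^{\min(m-1,\nu-1)}f_{m,\mu}e_{m,\nu-\mu-1}q^{\nu(n-m)}\Big)(-1)^{m+1}A'_{n-m}\,],$$ where sequences are taken to vanish at negative indices, and $$e_{m,i}:=\big(d^{m-1}e_{i+m-1}(u_1,\dots,u_{r-1})+d^me_{i+m}(u_1,\dots,u_{r-1})\big){i+m-1\brack m-1}_q,\qquad f_{m,k}:=u_r^kq^{k(k+1)/2}{m-1\brack k}_q.$$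
   Context: ${m\brack s}_q=\prod_{t=0}^{s-1}\frac{1-q^{m-t}}{1-q^{t+1}}$ for $0\le s\le m$, and $0$ otherwise. $e_n(u_1,\dots,u_s)$ (single index) is the $n$-th elementary symmetric polynomial in $u_1,\dots,u_s$, with $e_0=1$ and $e_n=0$ for $n<0$ or $n>s$; the doubly-indexed $e_{m,i}$ is as defined in the statement. $u_1,\dots,u_r,d,q$ are parameters. -}

module Defs where

open import Level using (_⊔_)
open import Algebra.Bundles using (CommutativeRing)
open import Data.Nat as ℕ using (ℕ; zero; suc; _∸_; _⊓_; _≤?_)
open import Data.Product using (_×_)
open import Relation.Nullary using (yes; no)

module WithRing {c ℓ} (R : CommutativeRing c ℓ) where
  open CommutativeRing R

  pow : Carrier → ℕ → Carrier
  pow x zero    = 1#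
  pow x (suc n) = x * pow x n

  sumTo : ℕ → (ℕ → Carrier) → Carrier
  sumTo zero    f = 0#
  sumTo (suc n) f = sumTo n f + f n

  prodTo : ℕ → (ℕ → Carrier) → Carrier
  prodTo zero    f = 1#
  prodTo (suc n) f = prodTo n f * f n

  -- e_k(u_1,…,u_s), the k-th elementary symmetric polynomial in u 1, …, u s
  esym : (ℕ → Carrier) → ℕ → ℕ → Carrier
  esym u s       zero    = 1#
  esym u zero    (suc k) = 0#
  esym u (suc s) (suc k) = esym u s (suc k) + u (suc s) * esym u s k

  -- Gaussian binomial [m brack s]_q (0 for s > m), via the q-Pascal rule
  -- [m+1, s+1] = [m, s] + q^(s+1) [m, s+1], which is the polynomial
  -- equal to Π_{t<s} (1-q^{m-t})/(1-q^{t+1}).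
  qbin : Carrier → ℕ → ℕ → Carrier
  qbin q m       zero    = 1#
  qbin q zero    (suc s) = 0#
  qbin q (suc m) (suc s) = qbin q m s + pow q (suc s) * qbin q m (suc s)

  shift : (ℕ → Carrier) → ℕ → ℕ → Carrier
  shift a n m with m ≤? n
  ... | yes _ = a (n ∸ m)
  ... | no  _ = 0#

  sgn : ℕ → Carrier
  sgn m = pow (- 1#) (suc m)

  module Params (r : ℕ) (u : ℕ → Carrier) (d q : Carrier) where

    emi : ℕ → ℕ → Carrier
    emi m i = (pow d (m ∸ 1) * esym u (r ∸ 1) (i ℕ.+ m ∸ 1)
               + pow d m * esym u (r ∸ 1) (i ℕ.+ m))
              * qbin q (i ℕ.+ m ∸ 1) (m ∸ 1)

    fmk : ℕ → ℕ → Carrier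
    fmk m k = pow (u r) k * pow q (k ℕ.* suc k ℕ./ 2) * qbin q (m ∸ 1) k

    RecA : (ℕ → Carrier) → Set ℓ
    RecA a = (a 0 ≈ 1#) ×
      ((n : ℕ) → (1# - pow q (suc n)) * a (suc n) ≈
        sumTo r (λ j → let m = suc j in
          sumTo r (λ i → emi m i * pow q (i ℕ.* (suc n ∸ m)) * sgn m * shift a (suc n) m)))

    coefB : ℕ → ℕ → Carrier
    coefB n m =
      sumTo r (λ ν → sumTo (suc ((m ∸ 1) ⊓ ν)) (λ μ →
          fmk m μ * emi m (ν ∸ μ) * pow q (ν ℕ.* (n ∸ m))))
      + u r * sumTo r (λ j → let ν = suc j in sumTo (suc ((m ∸ 1) ⊓ (ν ∸ 1))) (λ μ →
          fmk m μ * emi m (ν ∸ μ ∸ 1) * pow q (ν ℕ.* (n ∸ m))))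

    RecB : (ℕ → Carrier) → Set ℓ
    RecB A = (A 0 ≈ 1#) ×
      ((n : ℕ) → (1# - pow q (suc n)) * A (suc n) ≈
        sumTo r (λ j → let m = suc j in
          coefB (suc n) m * sgn m * shift A (suc n) m))

module Submission where

-- Put x = q^(n-m). The coefficient of (-1)^(m+1) A'_{n-m} in the second
-- recurrence factorises as (1 + u_r x) F_m(x) E_m(x), where E_m(x) = Σ_i e_{m,i} x^i
-- is the corresponding coefficient of the first recurrence and F_m(x) = Σ_k f_{m,k} x^k;
-- the convolution Σ_μ f_{m,μ} e_{m,ν-μ} comes from F_m E_m, and the second sum
-- over ν is x times the first. By Rothe's q-binomial theorem
-- (1 + u_r x) F_m(x) = Π_{i<m} (1 + u_r q^i x) = (-u_r;q)_n / (-u_r;q)_{n-m}.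
-- So the second recurrence is the first multiplied by (-u_r;q)_n, and the
-- converse holds because (-u_r;q)_n is a non-zero-divisor.

open import Defs
open import Algebra.Bundles using (CommutativeRing; Semiring)
open import Level using (_⊔_)
open import Data.Nat as ℕ using (ℕ; zero; suc; _≤_; _<_; _∸_; _⊓_; _≤?_; z≤n; s≤s)
import Data.Nat.Properties as ℕₚ
open import Data.Nat.DivMod using (_/_; m*n/n≡m; +-distrib-/-∣ʳ)
open import Data.Nat.Divisibility using (divides-refl)
open import Data.Nat.Tactic.RingSolver using (solve-∀)
open import Data.Product using (_×_; _,_)
open import Data.Sum using (inj₁; inj₂)
open import Relation.Binary.PropositionalEquality as ≡ using (_≡_)
open import Relation.Nullary using (yes; no)

triangle-suc : ∀ μ → suc μ ℕ.* suc (suc μ) / 2 ≡ μ ℕ.* suc μ / 2 ℕ.+ suc μ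
triangle-suc μ = begin
  suc μ ℕ.* suc (suc μ) / 2             ≡⟨ ≡.cong (_/ 2) (expand μ) ⟩
  (μ ℕ.* suc μ ℕ.+ suc μ ℕ.* 2) / 2     ≡⟨ +-distrib-/-∣ʳ (μ ℕ.* suc μ) (divides-refl (suc μ)) ⟩
  μ ℕ.* suc μ / 2 ℕ.+ suc μ ℕ.* 2 / 2   ≡⟨ ≡.cong (μ ℕ.* suc μ / 2 ℕ.+_) (m*n/n≡m (suc μ) 2) ⟩
  μ ℕ.* suc μ / 2 ℕ.+ suc μ             ∎
  where
  open ≡.≡-Reasoning
  expand : ∀ μ → suc μ ℕ.* suc (suc μ) ≡ μ ℕ.* suc μ ℕ.+ suc μ ℕ.* 2
  expand = solve-∀

m∸n≤o⇒m∸1<o+n : ∀ {m n o} → 0 < m → m ∸ n ≤ o → m ∸ 1 < o ℕ.+ n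
m∸n≤o⇒m∸1<o+n {suc m} {n} {o} _ m∸n≤o = begin
  suc m            ≤⟨ ℕₚ.m≤n+m∸n (suc m) n ⟩
  n ℕ.+ (suc m ∸ n) ≤⟨ ℕₚ.+-monoʳ-≤ n m∸n≤o ⟩
  n ℕ.+ o          ≡⟨ ℕₚ.+-comm n o ⟩
  o ℕ.+ n          ∎
  where open ℕₚ.≤-Reasoning

module _ {c ℓ} (R : CommutativeRing c ℓ) where
  open CommutativeRing R
  open WithRing R
  open import Relation.Binary.Reasoning.Setoid setoid
  open import Algebra.Definitions.RawSemiring (Semiring.rawSemiring semiring) using (_^_)
  open import Algebra.Properties.Semiring.Exp semiring using (^-congˡ; ^-homo-*; ^-assocʳ)
  open import Algebra.Properties.CommutativeSemiring.Exp commutativeSemiring using (^-distrib-*)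
  open import Algebra.Properties.CommutativeSemigroup *-commutativeSemigroup using (x∙yz≈y∙xz)
  open import Algebra.Properties.Ring ring using (x[y-z]≈xy-xz)
  open import Algebra.Properties.Group +-group using (x∙y⁻¹≈ε⇒x≈y)
  open import Algebra.Solver.Ring.NaturalCoefficients.Default commutativeSemiring
    using (solve; _:=_; _:+_; _:*_; con)

  pow≈^ : ∀ x n → pow x n ≈ x ^ n
  pow≈^ x zero    = refl
  pow≈^ x (suc n) = *-congˡ (pow≈^ x n)

  pow-+ : ∀ x m n → pow x (m ℕ.+ n) ≈ pow x m * pow x n
  pow-+ x m n = begin
    pow x (m ℕ.+ n)   ≈⟨ pow≈^ x (m ℕ.+ n) ⟩
    x ^ (m ℕ.+ n)     ≈⟨ ^-homo-* x m n ⟩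
    x ^ m * x ^ n     ≈⟨ sym (*-cong (pow≈^ x m) (pow≈^ x n)) ⟩
    pow x m * pow x n ∎

  pow-* : ∀ x m n → pow x (m ℕ.* n) ≈ pow (pow x n) m
  pow-* x m n = begin
    pow x (m ℕ.* n)  ≈⟨ pow≈^ x (m ℕ.* n) ⟩
    x ^ (m ℕ.* n)    ≈⟨ reflexive (≡.cong (x ^_) (ℕₚ.*-comm m n)) ⟩
    x ^ (n ℕ.* m)    ≈⟨ sym (^-assocʳ x n m) ⟩
    (x ^ n) ^ m      ≈⟨ sym (trans (pow≈^ (pow x n) m) (^-congˡ m (pow≈^ x n))) ⟩
    pow (pow x n) m  ∎

  pow-distrib-* : ∀ x y n → pow (x * y) n ≈ pow x n * pow y n
  pow-distrib-* x y n = begin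
    pow (x * y) n     ≈⟨ pow≈^ (x * y) n ⟩
    (x * y) ^ n       ≈⟨ ^-distrib-* x y n ⟩
    x ^ n * y ^ n     ≈⟨ sym (*-cong (pow≈^ x n) (pow≈^ y n)) ⟩
    pow x n * pow y n ∎

  VanishesFrom : ℕ → (ℕ → Carrier) → Set ℓ
  VanishesFrom n f = ∀ i → n ≤ i → f i ≈ 0#

  vanishesFrom-*ʳ : ∀ {n f} (g : ℕ → Carrier) → VanishesFrom n f → VanishesFrom n (λ i → f i * g i)
  vanishesFrom-*ʳ g f0 i n≤i = trans (*-congʳ (f0 i n≤i)) (zeroˡ (g i))

  sumTo-cong : ∀ n {f g : ℕ → Carrier} → (∀ i → i < n → f i ≈ g i) → sumTo n f ≈ sumTo n g
  sumTo-cong zero    f≈g = refl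
  sumTo-cong (suc n) f≈g = +-cong (sumTo-cong n (λ i i<n → f≈g i (ℕₚ.m≤n⇒m≤1+n i<n))) (f≈g n ℕₚ.≤-refl)

  sumTo-+ : ∀ n (f g : ℕ → Carrier) → sumTo n (λ i → f i + g i) ≈ sumTo n f + sumTo n g
  sumTo-+ zero    f g = sym (+-identityˡ 0#)
  sumTo-+ (suc n) f g = trans (+-congʳ (sumTo-+ n f g))
    (solve 4 (λ a b c d → (a :+ b) :+ (c :+ d) := (a :+ c) :+ (b :+ d)) refl
      (sumTo n f) (sumTo n g) (f n) (g n))

  sumTo-*ˡ : ∀ n x (f : ℕ → Carrier) → sumTo n (λ i → x * f i) ≈ x * sumTo n f
  sumTo-*ˡ zero    x f = sym (zeroʳ x)
  sumTo-*ˡ (suc n) x f = trans (+-congʳ (sumTo-*ˡ n x f)) (sym (distribˡ x (sumTo n f) (f n)))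

  sumTo-*ʳ : ∀ n x (f : ℕ → Carrier) → sumTo n (λ i → f i * x) ≈ sumTo n f * x
  sumTo-*ʳ zero    x f = sym (zeroˡ x)
  sumTo-*ʳ (suc n) x f = trans (+-congʳ (sumTo-*ʳ n x f)) (sym (distribʳ x (sumTo n f) (f n)))

  sumTo-suc : ∀ n (f : ℕ → Carrier) → sumTo (suc n) f ≈ f 0 + sumTo n (λ i → f (suc i))
  sumTo-suc zero    f = trans (+-identityˡ (f 0)) (sym (+-identityʳ (f 0)))
  sumTo-suc (suc n) f = trans (+-congʳ (sumTo-suc n f)) (+-assoc _ _ _)

  sumTo-vanishing : ∀ {m} n {f : ℕ → Carrier} → m ≤ n → VanishesFrom m f → sumTo n f ≈ sumTo m f
  sumTo-vanishing zero z≤n f0 = refl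
  sumTo-vanishing {m} (suc n) m≤1+n f0 with m ≤? n
  ... | yes m≤n = trans (+-cong (sumTo-vanishing n m≤n f0) (f0 n m≤n)) (+-identityʳ _)
  ... | no  m≰n = reflexive (≡.cong (λ k → sumTo k _) (≡.sym (ℕₚ.≤-antisym m≤1+n (ℕₚ.≰⇒> m≰n))))

  sumTo-⊓ : ∀ j ν {f : ℕ → Carrier} → VanishesFrom (suc j) f → sumTo (suc (j ⊓ ν)) f ≈ sumTo (suc ν) f
  sumTo-⊓ j ν f0 with ℕₚ.≤-total j ν
  ... | inj₁ j≤ν rewrite ℕₚ.m≤n⇒m⊓n≡m j≤ν = sym (sumTo-vanishing (suc ν) (s≤s j≤ν) f0)
  ... | inj₂ ν≤j rewrite ℕₚ.m≥n⇒m⊓n≡n ν≤j = refl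

  prodTo-cong : ∀ n {f g : ℕ → Carrier} → (∀ i → f i ≈ g i) → prodTo n f ≈ prodTo n g
  prodTo-cong zero    f≈g = refl
  prodTo-cong (suc n) f≈g = *-cong (prodTo-cong n f≈g) (f≈g n)

  prodTo-suc : ∀ n (f : ℕ → Carrier) → prodTo (suc n) f ≈ f 0 * prodTo n (λ i → f (suc i))
  prodTo-suc zero    f = trans (*-identityˡ (f 0)) (sym (*-identityʳ (f 0)))
  prodTo-suc (suc n) f = trans (*-congʳ (prodTo-suc n f)) (*-assoc _ _ _)

  prodTo-+ : ∀ m n (f : ℕ → Carrier) → prodTo (m ℕ.+ n) f ≈ prodTo m f * prodTo n (λ i → f (m ℕ.+ i))
  prodTo-+ m zero    f = trans (reflexive (≡.cong (λ k → prodTo k f) (ℕₚ.+-identityʳ m))) (sym (*-identityʳ _))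
  prodTo-+ m (suc n) f = begin
    prodTo (m ℕ.+ suc n) f                                  ≈⟨ reflexive (≡.cong (λ k → prodTo k f) (ℕₚ.+-suc m n)) ⟩
    prodTo (m ℕ.+ n) f * f (m ℕ.+ n)                        ≈⟨ *-congʳ (prodTo-+ m n f) ⟩
    prodTo m f * prodTo n (λ i → f (m ℕ.+ i)) * f (m ℕ.+ n) ≈⟨ *-assoc _ _ _ ⟩
    prodTo m f * prodTo (suc n) (λ i → f (m ℕ.+ i))         ∎

  NonZeroDivisor : Carrier → Set (c ⊔ ℓ)
  NonZeroDivisor x = ∀ y → x * y ≈ 0# → y ≈ 0#

  prodTo-nonZeroDivisor : ∀ {f : ℕ → Carrier} → (∀ k → NonZeroDivisor (f k)) → ∀ n → NonZeroDivisor (prodTo n f)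
  prodTo-nonZeroDivisor f-nzd zero    y 1y≈0 = trans (sym (*-identityˡ y)) 1y≈0
  prodTo-nonZeroDivisor f-nzd (suc n) y Πy≈0 =
    f-nzd n y (prodTo-nonZeroDivisor f-nzd n _ (trans (sym (*-assoc _ _ _)) Πy≈0))

  nonZeroDivisor-*-cancelˡ : ∀ {x y z} → NonZeroDivisor x → x * y ≈ x * z → y ≈ z
  nonZeroDivisor-*-cancelˡ {x} {y} {z} x-nzd xy≈xz = x∙y⁻¹≈ε⇒x≈y y z (x-nzd (y - z) (begin
    x * (y - z)   ≈⟨ x[y-z]≈xy-xz x y z ⟩
    x * y - x * z ≈⟨ +-congʳ xy≈xz ⟩
    x * z - x * z ≈⟨ -‿inverseʳ (x * z) ⟩
    0#            ∎))

  esym-vanishes : ∀ u {s k} → s < k → esym u s k ≈ 0#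
  esym-vanishes u {zero}  {suc k} _         = refl
  esym-vanishes u {suc s} {suc k} (s≤s s<k) =
    trans (+-cong (esym-vanishes u (ℕₚ.m≤n⇒m≤1+n s<k)) (trans (*-congˡ (esym-vanishes u s<k)) (zeroʳ _)))
          (+-identityˡ 0#)

  qbin-vanishes : ∀ q {m s} → m < s → qbin q m s ≈ 0#
  qbin-vanishes q {zero}  {suc s} _         = refl
  qbin-vanishes q {suc m} {suc s} (s≤s m<s) =
    trans (+-cong (qbin-vanishes q m<s) (trans (*-congˡ (qbin-vanishes q (ℕₚ.m≤n⇒m≤1+n m<s))) (zeroʳ _)))
          (+-identityˡ 0#)

  poly : ℕ → (ℕ → Carrier) → Carrier → Carrier
  poly n f x = sumTo n (λ i → f i * pow x i)

  poly-vanishing : ∀ {m} n {f : ℕ → Carrier} x → m ≤ n → VanishesFrom m f → poly n f x ≈ poly m f x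
  poly-vanishing n x m≤n f0 = sumTo-vanishing n m≤n (vanishesFrom-*ʳ (pow x) f0)

  sumTo-cauchy : ∀ (f g : ℕ → Carrier) x N →
    sumTo N (λ ν → sumTo (suc ν) (λ μ → f μ * g (ν ∸ μ) * pow x ν)) ≈
    sumTo N (λ μ → f μ * pow x μ * poly (N ∸ μ) g x)
  sumTo-cauchy f g x zero    = refl
  sumTo-cauchy f g x (suc N) = begin
    sumTo N (λ ν → sumTo (suc ν) (λ μ → f μ * g (ν ∸ μ) * pow x ν)) + sumTo (suc N) diagonal
      ≈⟨ +-congʳ (trans (sumTo-cauchy f g x N) (sym last-vanishes)) ⟩
    sumTo (suc N) (outer N) + sumTo (suc N) diagonal
      ≈⟨ sym (sumTo-+ (suc N) (outer N) diagonal) ⟩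
    sumTo (suc N) (λ μ → outer N μ + diagonal μ)
      ≈⟨ sumTo-cong (suc N) absorb ⟩
    sumTo (suc N) (outer (suc N)) ∎
    where
    outer : ℕ → ℕ → Carrier
    outer M μ = f μ * pow x μ * poly (M ∸ μ) g x
    diagonal : ℕ → Carrier
    diagonal μ = f μ * g (N ∸ μ) * pow x N
    last-vanishes : sumTo (suc N) (outer N) ≈ sumTo N (outer N)
    last-vanishes = trans (+-congˡ (trans (*-congˡ (reflexive (≡.cong (λ k → poly k g x) (ℕₚ.n∸n≡0 N))))
                                          (zeroʳ _)))
                          (+-identityʳ _)
    absorb : ∀ μ → μ < suc N → outer N μ + diagonal μ ≈ outer (suc N) μ
    absorb μ (s≤s μ≤N) = begin
      f μ * pow x μ * poly (N ∸ μ) g x + f μ * g (N ∸ μ) * pow x N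
        ≈⟨ +-congˡ (*-congˡ (trans (reflexive (≡.cong (pow x) (≡.sym (ℕₚ.m+[n∸m]≡n μ≤N))))
                                   (pow-+ x μ (N ∸ μ)))) ⟩
      f μ * pow x μ * poly (N ∸ μ) g x + f μ * g (N ∸ μ) * (pow x μ * pow x (N ∸ μ))
        ≈⟨ solve 5 (λ a b S c e → a :* b :* S :+ a :* c :* (b :* e) := a :* b :* (S :+ c :* e)) refl
             (f μ) (pow x μ) (poly (N ∸ μ) g x) (g (N ∸ μ)) (pow x (N ∸ μ)) ⟩
      f μ * pow x μ * poly (suc (N ∸ μ)) g x
        ≈⟨ reflexive (≡.cong (λ k → f μ * pow x μ * poly k g x) (≡.sym (ℕₚ.+-∸-assoc 1 μ≤N))) ⟩
      outer (suc N) μ ∎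

  cauchy-product : ∀ (f g : ℕ → Carrier) x {M K N} → M ≤ N → M ℕ.+ K ≤ suc N →
    VanishesFrom M f → VanishesFrom K g →
    sumTo N (λ ν → sumTo (suc ν) (λ μ → f μ * g (ν ∸ μ) * pow x ν)) ≈ poly M f x * poly K g x
  cauchy-product f g x {M} {K} {N} M≤N M+K≤1+N f0 g0 = begin
    sumTo N (λ ν → sumTo (suc ν) (λ μ → f μ * g (ν ∸ μ) * pow x ν))
      ≈⟨ sumTo-cauchy f g x N ⟩
    sumTo N (λ μ → f μ * pow x μ * poly (N ∸ μ) g x)
      ≈⟨ sumTo-vanishing N M≤N (vanishesFrom-*ʳ _ (vanishesFrom-*ʳ (pow x) f0)) ⟩
    sumTo M (λ μ → f μ * pow x μ * poly (N ∸ μ) g x)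
      ≈⟨ sumTo-cong M (λ μ μ<M → *-congˡ (poly-vanishing (N ∸ μ) x (K≤N∸μ μ<M) g0)) ⟩
    sumTo M (λ μ → f μ * pow x μ * poly K g x)
      ≈⟨ sumTo-*ʳ M (poly K g x) (λ μ → f μ * pow x μ) ⟩
    poly M f x * poly K g x ∎
    where
    K≤N∸μ : ∀ {μ} → μ < M → K ≤ N ∸ μ
    K≤N∸μ μ<M = ℕₚ.≤-trans (ℕₚ.m+n≤o⇒m≤o∸n K (ℕₚ.≤-trans (ℕₚ.≤-reflexive (ℕₚ.+-comm K M)) M+K≤1+N))
                            (ℕₚ.∸-monoʳ-≤ (suc N) μ<M)

  qPochhammer : Carrier → Carrier → ℕ → Carrier
  qPochhammer z q n = prodTo n (λ k → 1# + z * pow q k)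

  qPochhammer-+ : ∀ z q m n → qPochhammer z q (m ℕ.+ n) ≈ qPochhammer z q m * qPochhammer (z * pow q m) q n
  qPochhammer-+ z q m n = trans (prodTo-+ m n _)
    (*-congˡ (prodTo-cong n (λ i → +-congˡ (trans (*-congˡ (pow-+ q m i)) (sym (*-assoc z _ _))))))

  qbinCoeff : Carrier → ℕ → ℕ → Carrier
  qbinCoeff q m μ = pow q (μ ℕ.* suc μ / 2) * qbin q m μ

  qbinCoeff-pascal : ∀ q w m μ →
    qbinCoeff q (suc m) (suc μ) * pow w (suc μ) ≈
    w * q * (qbinCoeff q m μ * pow (w * q) μ) + qbinCoeff q m (suc μ) * pow (w * q) (suc μ)
  qbinCoeff-pascal q w m μ = begin
    pow q (suc μ ℕ.* suc (suc μ) / 2) * (B₀ + q * qμ * B₁) * (w * wμ)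
      ≈⟨ *-congʳ (*-congʳ triangle) ⟩
    Q * (q * qμ) * (B₀ + q * qμ * B₁) * (w * wμ)
      ≈⟨ solve 7 (λ Q q qμ w wμ B₀ B₁ →
           Q :* (q :* qμ) :* (B₀ :+ q :* qμ :* B₁) :* (w :* wμ) :=
           w :* q :* (Q :* B₀ :* (wμ :* qμ)) :+ Q :* (q :* qμ) :* B₁ :* ((w :* wμ) :* (q :* qμ)))
           refl Q q qμ w wμ B₀ B₁ ⟩
    w * q * (Q * B₀ * (wμ * qμ)) + Q * (q * qμ) * B₁ * ((w * wμ) * (q * qμ))
      ≈⟨ sym (+-cong (*-congˡ (*-congˡ (pow-distrib-* w q μ)))
                     (*-cong (*-congʳ triangle) (pow-distrib-* w q (suc μ)))) ⟩
    w * q * (qbinCoeff q m μ * pow (w * q) μ) + qbinCoeff q m (suc μ) * pow (w * q) (suc μ) ∎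
    where
    Q = pow q (μ ℕ.* suc μ / 2)
    qμ = pow q μ
    wμ = pow w μ
    B₀ = qbin q m μ
    B₁ = qbin q m (suc μ)
    triangle : pow q (suc μ ℕ.* suc (suc μ) / 2) ≈ Q * (q * qμ)
    triangle = trans (reflexive (≡.cong (pow q) (triangle-suc μ))) (pow-+ q (μ ℕ.* suc μ / 2) (suc μ))

  q-binomial : ∀ q w m → qPochhammer (w * q) q m ≈ poly (suc m) (qbinCoeff q m) w
  q-binomial q w zero    = sym (trans (+-identityˡ _) (trans (*-identityʳ _) (*-identityʳ 1#)))
  q-binomial q w (suc m) = begin
    qPochhammer (w * q) q (suc m)
      ≈⟨ prodTo-suc m _ ⟩
    (1# + w * q * 1#) * prodTo m (λ i → 1# + w * q * (q * pow q i))
      ≈⟨ *-cong (+-congˡ (*-identityʳ _)) (prodTo-cong m (λ i → +-congˡ (sym (*-assoc _ q _)))) ⟩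
    (1# + wq) * qPochhammer (wq * q) q m
      ≈⟨ *-congˡ (q-binomial q wq m) ⟩
    (1# + wq) * S
      ≈⟨ solve 2 (λ x S → (con 1 :+ x) :* S := x :* S :+ S) refl wq S ⟩
    wq * S + S
      ≈⟨ +-congˡ (sym (trans (+-congʳ (sym b₀≈1)) (trans (sym (sumTo-suc (suc m) b)) b-vanishing))) ⟩
    wq * S + (1# + T)
      ≈⟨ solve 3 (λ x S T → x :* S :+ (con 1 :+ T) := con 1 :+ (x :* S :+ T)) refl wq S T ⟩
    1# + (wq * S + T)
      ≈⟨ +-congˡ (sym (trans (sumTo-+ (suc m) _ _) (+-congʳ (sumTo-*ˡ (suc m) wq b)))) ⟩
    1# + sumTo (suc m) (λ μ → wq * b μ + b (suc μ))
      ≈⟨ sym (+-cong (trans (*-identityʳ _) (*-identityʳ 1#))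
                     (sumTo-cong (suc m) (λ μ _ → qbinCoeff-pascal q w m μ))) ⟩
    qbinCoeff q (suc m) 0 * pow w 0 + sumTo (suc m) (λ μ → qbinCoeff q (suc m) (suc μ) * pow w (suc μ))
      ≈⟨ sym (sumTo-suc (suc m) _) ⟩
    poly (suc (suc m)) (qbinCoeff q (suc m)) w ∎
    where
    wq = w * q
    b : ℕ → Carrier
    b μ = qbinCoeff q m μ * pow wq μ
    S = sumTo (suc m) b
    T = sumTo (suc m) (λ μ → b (suc μ))
    b₀≈1 : b 0 ≈ 1#
    b₀≈1 = trans (*-identityʳ _) (*-identityʳ 1#)
    b-vanishing : sumTo (suc (suc m)) b ≈ S
    b-vanishing = sumTo-vanishing (suc (suc m)) (ℕₚ.n≤1+n (suc m))
      (vanishesFrom-*ʳ (pow wq) (λ μ m<μ → trans (*-congˡ (qbin-vanishes q m<μ)) (zeroʳ _)))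

  module _ (r : ℕ) (u : ℕ → Carrier) (d q : Carrier) where
    open Params r u d q

    private
      U = u r

    fmk-vanishes : ∀ j → VanishesFrom (suc j) (fmk (suc j))
    fmk-vanishes j μ j<μ = trans (*-congˡ (qbin-vanishes q j<μ)) (zeroʳ _)

    emi-vanishes : ∀ {j} → j < r → VanishesFrom (r ∸ j) (emi (suc j))
    emi-vanishes {j} j<r i r∸j≤i =
      trans (*-congʳ (trans (+-cong (right-factor-zero (esym-vanishes u below₀)) (right-factor-zero (esym-vanishes u below₁)))
                            (+-identityˡ 0#)))
            (zeroˡ _)
      where
      right-factor-zero : ∀ {x e} → e ≈ 0# → x * e ≈ 0#
      right-factor-zero e≈0 = trans (*-congˡ e≈0) (zeroʳ _)
      r∸1<i+j : r ∸ 1 < i ℕ.+ j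
      r∸1<i+j = m∸n≤o⇒m∸1<o+n (ℕₚ.m<n⇒0<n j<r) r∸j≤i
      below₀ : r ∸ 1 < i ℕ.+ suc j ∸ 1
      below₀ = ℕₚ.≤-trans r∸1<i+j (ℕₚ.≤-reflexive (≡.cong (_∸ 1) (≡.sym (ℕₚ.+-suc i j))))
      below₁ : r ∸ 1 < i ℕ.+ suc j
      below₁ = ℕₚ.≤-trans r∸1<i+j (ℕₚ.+-monoʳ-≤ i (ℕₚ.n≤1+n j))

    fmk-generating : ∀ j x → qPochhammer (U * x) q (suc j) ≈ (1# + U * x) * poly (suc j) (fmk (suc j)) x
    fmk-generating j x = begin
      qPochhammer (U * x) q (suc j)
        ≈⟨ prodTo-suc j _ ⟩
      (1# + U * x * 1#) * prodTo j (λ i → 1# + U * x * (q * pow q i))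
        ≈⟨ *-cong (+-congˡ (*-identityʳ _)) (prodTo-cong j (λ i → +-congˡ (sym (*-assoc _ q _)))) ⟩
      (1# + U * x) * qPochhammer (U * x * q) q j
        ≈⟨ *-congˡ (trans (q-binomial q (U * x) j) (sumTo-cong (suc j) (λ μ _ → coefficient μ))) ⟩
      (1# + U * x) * poly (suc j) (fmk (suc j)) x ∎
      where
      coefficient : ∀ μ → qbinCoeff q j μ * pow (U * x) μ ≈ fmk (suc j) μ * pow x μ
      coefficient μ = trans (*-congˡ (pow-distrib-* U x μ))
        (solve 4 (λ Q B Uμ xμ → Q :* B :* (Uμ :* xμ) := Uμ :* Q :* B :* xμ) refl
          (pow q (μ ℕ.* suc μ / 2)) (qbin q j μ) (pow U μ) (pow x μ))

    coefB-factorises : ∀ N {j} → j < r → let x = pow q (N ∸ suc j) in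
      coefB N (suc j) ≈ (1# + U * x) * (poly (suc j) (fmk (suc j)) x * poly (r ∸ j) (emi (suc j)) x)
    coefB-factorises N {j} j<r = begin
      coefB N m
        ≈⟨ +-cong diagonal-sum (*-congˡ shifted-sum) ⟩
      C + U * (x * C)
        ≈⟨ solve 3 (λ U x C → C :+ U :* (x :* C) := (con 1 :+ U :* x) :* C) refl U x C ⟩
      (1# + U * x) * C
        ≈⟨ *-congˡ (cauchy-product (fmk m) (emi m) x j<r M+K≤1+N (fmk-vanishes j) (emi-vanishes j<r)) ⟩
      (1# + U * x) * (poly m (fmk m) x * poly (r ∸ j) (emi m) x) ∎
      where
      m = suc j
      k = N ∸ m
      x = pow q k
      C = sumTo r (λ ν → sumTo (suc ν) (λ μ → fmk m μ * emi m (ν ∸ μ) * pow x ν))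
      M+K≤1+N : m ℕ.+ (r ∸ j) ≤ suc r
      M+K≤1+N = ℕₚ.≤-reflexive (≡.cong suc (ℕₚ.m+[n∸m]≡n (ℕₚ.<⇒≤ j<r)))
      truncate : ∀ ν (e : ℕ → Carrier) (p : Carrier) →
        sumTo (suc (j ⊓ ν)) (λ μ → fmk m μ * e μ * p) ≈ sumTo (suc ν) (λ μ → fmk m μ * e μ * p)
      truncate ν e p = sumTo-⊓ j ν (vanishesFrom-*ʳ (λ _ → p) (vanishesFrom-*ʳ e (fmk-vanishes j)))
      diagonal-sum :
        sumTo r (λ ν → sumTo (suc (j ⊓ ν)) (λ μ → fmk m μ * emi m (ν ∸ μ) * pow q (ν ℕ.* k))) ≈ C
      diagonal-sum = sumTo-cong r (λ ν _ → trans (truncate ν _ _)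
        (sumTo-cong (suc ν) (λ μ _ → *-congˡ (pow-* q ν k))))
      shifted-term : ∀ ν μ →
        fmk m μ * emi m (suc ν ∸ μ ∸ 1) * pow q (suc ν ℕ.* k) ≈ x * (fmk m μ * emi m (ν ∸ μ) * pow x ν)
      shifted-term ν μ = begin
        fmk m μ * emi m (suc ν ∸ μ ∸ 1) * pow q (suc ν ℕ.* k)
          ≈⟨ *-cong (*-congˡ (reflexive (≡.cong (emi m) index))) (pow-* q (suc ν) k) ⟩
        fmk m μ * emi m (ν ∸ μ) * (x * pow x ν)
          ≈⟨ x∙yz≈y∙xz _ x (pow x ν) ⟩
        x * (fmk m μ * emi m (ν ∸ μ) * pow x ν) ∎
        where
        index : suc ν ∸ μ ∸ 1 ≡ ν ∸ μ
        index = ≡.trans (ℕₚ.∸-+-assoc (suc ν) μ 1) (≡.cong (suc ν ∸_) (ℕₚ.+-comm μ 1))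
      shifted-sum :
        sumTo r (λ ν → sumTo (suc (j ⊓ ν)) (λ μ → fmk m μ * emi m (suc ν ∸ μ ∸ 1) * pow q (suc ν ℕ.* k)))
          ≈ x * C
      shifted-sum = trans (sumTo-cong r (λ ν _ → trans (truncate ν _ _)
                                          (trans (sumTo-cong (suc ν) (λ μ _ → shifted-term ν μ))
                                                 (sumTo-*ˡ (suc ν) x _))))
                          (sumTo-*ˡ r x _)

    coefB-qPochhammer : ∀ N {j} → j < r → suc j ≤ N →
      coefB N (suc j) * qPochhammer U q (N ∸ suc j) ≈
      qPochhammer U q N * sumTo r (λ i → emi (suc j) i * pow q (i ℕ.* (N ∸ suc j)))
    coefB-qPochhammer N {j} j<r m≤N = begin
      coefB N m * qPochhammer U q k
        ≈⟨ *-congʳ (coefB-factorises N j<r) ⟩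
      (1# + U * x) * (F * G) * qPochhammer U q k
        ≈⟨ solve 4 (λ A F G P → A :* (F :* G) :* P := P :* (A :* F) :* G) refl
             (1# + U * x) F G (qPochhammer U q k) ⟩
      qPochhammer U q k * ((1# + U * x) * F) * G
        ≈⟨ *-cong (*-congˡ (sym (fmk-generating j x))) (sym E≈G) ⟩
      qPochhammer U q k * qPochhammer (U * x) q m * E
        ≈⟨ *-congʳ (sym (trans (reflexive (≡.cong (qPochhammer U q) (≡.sym (ℕₚ.m∸n+n≡m m≤N))))
                               (qPochhammer-+ U q k m))) ⟩
      qPochhammer U q N * E ∎
      where
      m = suc j
      k = N ∸ m
      x = pow q k
      F = poly m (fmk m) x
      G = poly (r ∸ j) (emi m) x
      E = sumTo r (λ i → emi m i * pow q (i ℕ.* k))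
      E≈G : E ≈ G
      E≈G = trans (sumTo-cong r (λ i _ → *-congˡ (pow-* q i k)))
                  (poly-vanishing r x (ℕₚ.m∸n≤m r j) (emi-vanishes j<r))

    module _ {a A' : ℕ → Carrier} (A'≈ : ∀ n → A' n ≈ a n * qPochhammer U q n) where

      coefB-term : ∀ N {j} → j < r →
        coefB N (suc j) * sgn (suc j) * shift A' N (suc j) ≈
        qPochhammer U q N * sumTo r (λ i → emi (suc j) i * pow q (i ℕ.* (N ∸ suc j)) * sgn (suc j) * shift a N (suc j))
      coefB-term N {j} j<r with suc j ≤? N
      ... | no  _   = trans (zeroʳ _) (sym (trans (*-congˡ (sumTo-vanishing r z≤n (λ i _ → zeroʳ _))) (zeroʳ _)))
      ... | yes m≤N = begin
        coefB N m * s * A' k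
          ≈⟨ *-congˡ (A'≈ k) ⟩
        coefB N m * s * (a k * qPochhammer U q k)
          ≈⟨ solve 4 (λ c s a P → c :* s :* (a :* P) := c :* P :* (s :* a)) refl
               (coefB N m) s (a k) (qPochhammer U q k) ⟩
        coefB N m * qPochhammer U q k * (s * a k)
          ≈⟨ *-congʳ (coefB-qPochhammer N j<r m≤N) ⟩
        qPochhammer U q N * E * (s * a k)
          ≈⟨ *-assoc _ _ _ ⟩
        qPochhammer U q N * (E * (s * a k))
          ≈⟨ *-congˡ (sym (trans (sumTo-cong r (λ i _ → *-assoc _ _ _)) (sumTo-*ʳ r _ _))) ⟩
        qPochhammer U q N * sumTo r (λ i → emi m i * pow q (i ℕ.* k) * s * a k) ∎
        where
        m = suc j
        k = N ∸ m
        s = sgn m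
        E = sumTo r (λ i → emi m i * pow q (i ℕ.* k))

      rhsB≈qPochhammer*rhsA : ∀ N →
        sumTo r (λ j → coefB N (suc j) * sgn (suc j) * shift A' N (suc j)) ≈
        qPochhammer U q N * sumTo r (λ j → sumTo r (λ i →
          emi (suc j) i * pow q (i ℕ.* (N ∸ suc j)) * sgn (suc j) * shift a N (suc j)))
      rhsB≈qPochhammer*rhsA N = trans (sumTo-cong r (λ j j<r → coefB-term N j<r)) (sumTo-*ˡ r _ _)

      lhsB≈qPochhammer*lhsA : ∀ y N → y * A' N ≈ qPochhammer U q N * (y * a N)
      lhsB≈qPochhammer*lhsA y N =
        trans (*-congˡ (trans (A'≈ N) (*-comm _ _))) (x∙yz≈y∙xz y (qPochhammer U q N) (a N))

      RecA⇒RecB : RecA a → RecB A'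
      RecA⇒RecB (a₀≈1 , recA) = trans (A'≈ 0) (trans (*-identityʳ _) a₀≈1) , λ n →
        trans (lhsB≈qPochhammer*lhsA _ (suc n))
              (trans (*-congˡ (recA n)) (sym (rhsB≈qPochhammer*rhsA (suc n))))

      RecB⇒RecA : (∀ k → NonZeroDivisor (1# + U * pow q k)) → RecB A' → RecA a
      RecB⇒RecA nzd (A'₀≈1 , recB) = trans (sym (*-identityʳ _)) (trans (sym (A'≈ 0)) A'₀≈1) , λ n →
        nonZeroDivisor-*-cancelˡ (prodTo-nonZeroDivisor nzd (suc n))
          (trans (sym (lhsB≈qPochhammer*lhsA _ (suc n)))
                 (trans (recB n) (rhsB≈qPochhammer*rhsA (suc n))))

lemma3p10 : ∀ {c ℓ} (R : CommutativeRing c ℓ) (r : ℕ) → 2 ≤ r →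
    (u : ℕ → CommutativeRing.Carrier R) (d q : CommutativeRing.Carrier R) →
    (∀ k x → CommutativeRing._≈_ R (CommutativeRing._*_ R (CommutativeRing._+_ R (CommutativeRing.1# R) (CommutativeRing._*_ R (u r) (WithRing.pow R q k))) x) (CommutativeRing.0# R) → CommutativeRing._≈_ R x (CommutativeRing.0# R)) →
    (a A' : ℕ → CommutativeRing.Carrier R) →
    (∀ n → CommutativeRing._≈_ R (A' n) (CommutativeRing._*_ R (a n) (WithRing.prodTo R n (λ k → CommutativeRing._+_ R (CommutativeRing.1# R) (CommutativeRing._*_ R (u r) (WithRing.pow R q k)))))) →
    (WithRing.Params.RecA R r u d q a → WithRing.Params.RecB R r u d q A') ×
    (WithRing.Params.RecB R r u d q A' → WithRing.Params.RecA R r u d q a)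
lemma3p10 R r _ u d q nzd a A' A'≈ =
  RecA⇒RecB R r u d q A'≈ , RecB⇒RecA R r u d q A'≈ nzd
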